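{- Let $C(m,n;k,l;c,d)$ be a $C$-shaped supergrid graph. Then $C(m,n;k,l;c,d)$ contains a Hamiltonian cycle if and only if it does not satisfy the following condition: $a(=m-k)=1$, or there exists a vertex $w\in V(C(m,n;k,l;c,d))$ with $\deg(w)=1$.
   Context: A supergrid graph is a finite vertex-induced subgraph of the infinite graph on integer points of the plane where two vertices are adjacent iff their $x$ and $y$ coordinates each differ by at most 1. $R(m,n)$ is the rectangular supergrid graph on vertices $\{(x,y):1\le x\le m,1\le y\le n\}$. The $C$-shaped supergrid graph $C(m,n;k,l;c,d)$ is obtained from $R(m,n)$ by removing a subgraph $R(k,l)$ starting at the node $(m,c+1)$ such that $R(m,n)$ and $R(k,l)$ share exactly one border side, where $m\ge 2$, $n\ge 3$, $k,l\ge 1$, $c\ge 1$, $d=n-l-c\ge 1$, and $a=m-k\ge 1$. -}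

module Defs where

open import Data.Nat using (ℕ; zero; suc; _+_; _∸_; _≤_; _<_; _≤?_; _<?_; ∣_-_∣)
open import Data.Nat.Properties using (_≟_)
open import Data.Product using (_×_; _,_; Σ; ∃; proj₁; proj₂)
open import Data.Product.Properties using (≡-dec)
open import Data.List using (List; []; _∷_; _++_; length; filter; concatMap; map; upTo)
open import Data.List.Membership.Propositional using (_∈_)
open import Data.List.Relation.Unary.Unique.Propositional using (Unique)
open import Data.Unit using (⊤)
open import Relation.Binary.PropositionalEquality using (_≡_; _≢_)
open import Relation.Nullary using (¬_; Dec)
open import Relation.Nullary.Decidable using (_×-dec_; ¬?)
open import Function.Bundles using (_⇔_)

-- Points of the integer plane (only positive coordinates are ever used).
Point : Set
Point = ℕ × ℕ

Adj : Point → Point → Set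
Adj (x , y) (x' , y') = ((x , y) ≢ (x' , y')) × (∣ x - x' ∣ ≤ 1) × (∣ y - y' ∣ ≤ 1)

Adj? : ∀ u v → Dec (Adj u v)
Adj? (x , y) (x' , y') =
  ¬? (≡-dec _≟_ _≟_ (x , y) (x' , y')) ×-dec (∣ x - x' ∣ ≤? 1) ×-dec (∣ y - y' ∣ ≤? 1)

-- Vertex set of the C-shaped supergrid graph C(m,n;k,l;c,d):
-- R(m,n) minus the rectangle R(k,l) placed at x ∈ [m-k+1, m], y ∈ [c+1, c+l]
-- (sharing the border side x = m with R(m,n)).
InC : (m n k l c : ℕ) → Point → Set
InC m n k l c (x , y) =
  (1 ≤ x) × (x ≤ m) × (1 ≤ y) × (y ≤ n) × ¬ ((m ∸ k < x) × (c < y) × (y ≤ c + l))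

InC? : ∀ m n k l c (p : Point) → Dec (InC m n k l c p)
InC? m n k l c (x , y) =
  (1 ≤? x) ×-dec (x ≤? m) ×-dec (1 ≤? y) ×-dec (y ≤? n)
    ×-dec ¬? ((m ∸ k <? x) ×-dec (c <? y) ×-dec (y ≤? c + l))

box : ℕ → ℕ → List Point
box m n = concatMap (λ i → map (λ j → (suc i , suc j)) (upTo n)) (upTo m)

degC : (m n k l c : ℕ) → Point → ℕ
degC m n k l c w = length (filter (λ v → Adj? w v ×-dec InC? m n k l c v) (box m n))

Consec : List Point → Set
Consec [] = ⊤
Consec (u ∷ []) = ⊤
Consec (u ∷ v ∷ vs) = Adj u v × Consec (v ∷ vs)

HamiltonianCycle : (Point → Set) → Set
HamiltonianCycle V =
  Σ Point λ u → Σ (List Point) λ vs →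
    Unique (u ∷ vs) × (3 ≤ length (u ∷ vs)) ×
    (∀ p → V p ⇔ p ∈ (u ∷ vs)) ×
    Consec ((u ∷ vs) ++ (u ∷ []))

-- A Hamiltonian cycle gives every vertex two distinct neighbours, so no vertex may have degree one.
-- If a = m - k = 1, the only vertex outside the top arm (rows y ≤ c) adjacent to it is (1, c + 1);
-- deleting it from a Hamiltonian cycle leaves a path through all other vertices that never crosses
-- between the top arm and the rest, although it visits both (1, 1) and (1, n).
-- Conversely, if a ≥ 2 and no vertex has degree one, then the corners (m, 1) and (m, n) force
-- k = 1 or c ≥ 2, resp. k = 1 or d ≥ 2. Under these conditions the graph without its first column
-- has a Hamiltonian path from (2, 1) to (2, n), glued together from boustrophedon paths of the
-- rectangles making up the top arm, the middle strip [2, a] × [c + 1, c + l] and the bottom arm,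
-- plus one hand-made path for a ≥ 3, k = c = l = d = 1. Returning up the first column closes it.

module Submission where

open import Defs
open import Data.Nat using (ℕ; zero; suc; _+_; _∸_; _≤_; _<_; z≤n; s≤s; s≤s⁻¹; ∣_-_∣; _≤?_)
open import Data.Nat.Properties
open import Data.Product using (_×_; _,_; Σ; ∃; proj₁; proj₂)
open import Data.Sum using (_⊎_; inj₁; inj₂; swap; map₁)
open import Data.List using (List; []; _∷_; _++_; length; filter; map; concatMap; upTo; cartesianProductWith)
open import Data.List.Properties using (filter-accept; filter-reject; filter-none; ++-assoc)
open import Data.List.Membership.Propositional using (_∈_)
open import Data.List.Membership.Propositional.Properties
  using (∈-map⁺; ∈-map⁻; ∈-++⁺ˡ; ∈-++⁺ʳ; ∈-++⁻; ∈-cartesianProductWith⁺; ∈-upTo⁺; ∈-filter⁺; ∈-∃++)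
open import Data.List.Relation.Unary.Any using (here; there)
open import Data.List.Relation.Unary.All using (All; []; _∷_)
import Data.List.Relation.Unary.All as All
open import Data.List.Relation.Unary.AllPairs using ([]; _∷_)
open import Data.List.Relation.Unary.Unique.Propositional using (Unique)
import Data.List.Relation.Unary.Unique.Propositional.Properties as Unique
open import Data.Empty using (⊥-elim)
open import Data.Unit using (tt)
open import Relation.Binary.PropositionalEquality
open import Relation.Nullary using (¬_; Dec; yes; no)
open import Relation.Nullary.Decidable using (_×-dec_)
open import Data.List.Relation.Binary.Permutation.Propositional using (_↭_; ↭-sym; ↭⇒↭ₛ)
open import Data.List.Relation.Binary.Permutation.Propositional.Properties using (++-comm; ↭-length; ∈-resp-↭)
open import Data.List.Relation.Binary.Permutation.Setoid.Properties (setoid Point) using (Unique-resp-↭)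
open import Relation.Unary using (_⊆_; _≐_; _∪_; ｛_｝) renaming (_⊥_ to Disjoint)
open import Relation.Unary.Properties using (≐-sym)
open import Function using (_∘_)
open import Function.Bundles using (_⇔_; mk⇔; Equivalence)

∣m-n∣≤1⇒m≤1+n : ∀ m n → ∣ m - n ∣ ≤ 1 → m ≤ suc n
∣m-n∣≤1⇒m≤1+n zero    n       _         = z≤n
∣m-n∣≤1⇒m≤1+n (suc m) zero    (s≤s z≤n) = s≤s z≤n
∣m-n∣≤1⇒m≤1+n (suc m) (suc n) h         = s≤s (∣m-n∣≤1⇒m≤1+n m n h)

m≤1+n⇒n≤1+m⇒∣m-n∣≤1 : ∀ m n → m ≤ suc n → n ≤ suc m → ∣ m - n ∣ ≤ 1
m≤1+n⇒n≤1+m⇒∣m-n∣≤1 zero          zero          _       _       = z≤n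
m≤1+n⇒n≤1+m⇒∣m-n∣≤1 zero          (suc zero)    _       _       = s≤s z≤n
m≤1+n⇒n≤1+m⇒∣m-n∣≤1 (suc zero)    zero          _       _       = s≤s z≤n
m≤1+n⇒n≤1+m⇒∣m-n∣≤1 (suc m)       (suc n)       (s≤s p) (s≤s q) = m≤1+n⇒n≤1+m⇒∣m-n∣≤1 m n p q
m≤1+n⇒n≤1+m⇒∣m-n∣≤1 zero          (suc (suc n)) _       (s≤s ())
m≤1+n⇒n≤1+m⇒∣m-n∣≤1 (suc (suc m)) zero          (s≤s ()) _

∣m-n∣≤1⇒∣n-m∣≤1 : ∀ m n → ∣ m - n ∣ ≤ 1 → ∣ n - m ∣ ≤ 1
∣m-n∣≤1⇒∣n-m∣≤1 m n = subst (_≤ 1) (∣-∣-comm m n)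

Adj-intro : ∀ {x y x' y'} → x ≤ suc x' → x' ≤ suc x → y ≤ suc y' → y' ≤ suc y →
            x ≢ x' ⊎ y ≢ y' → Adj (x , y) (x' , y')
Adj-intro {x} {y} {x'} {y'} x≤ x'≤ y≤ y'≤ different =
  distinct different , m≤1+n⇒n≤1+m⇒∣m-n∣≤1 x x' x≤ x'≤ , m≤1+n⇒n≤1+m⇒∣m-n∣≤1 y y' y≤ y'≤
  where
  distinct : x ≢ x' ⊎ y ≢ y' → (x , y) ≢ (x' , y')
  distinct (inj₁ x≢x') refl = x≢x' refl
  distinct (inj₂ y≢y') refl = y≢y' refl

Adj-sym : ∀ {p q} → Adj p q → Adj q p
Adj-sym {x , y} {x' , y'} (p≢q , near-x , near-y) =
  (λ q≡p → p≢q (sym q≡p)) , ∣m-n∣≤1⇒∣n-m∣≤1 x x' near-x , ∣m-n∣≤1⇒∣n-m∣≤1 y y' near-y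

-- Rows are indexed by y and drawn from top to bottom, so ↓ increases y.
adj→ : ∀ x y → Adj (x , y) (suc x , y)
adj→ x y = Adj-intro (m≤n+m x 2) ≤-refl (n≤1+n y) (n≤1+n y) (inj₁ (λ ()))

adj← : ∀ x y → Adj (suc x , y) (x , y)
adj← x y = Adj-sym (adj→ x y)

adj↓ : ∀ x y → Adj (x , y) (x , suc y)
adj↓ x y = Adj-intro (n≤1+n x) (n≤1+n x) (m≤n+m y 2) ≤-refl (inj₂ (λ ()))

adj↘ : ∀ x y → Adj (x , y) (suc x , suc y)
adj↘ x y = Adj-intro (m≤n+m x 2) ≤-refl (m≤n+m y 2) ≤-refl (inj₁ (λ ()))

adj↖ : ∀ x y → Adj (suc x , suc y) (x , y)
adj↖ x y = Adj-sym (adj↘ x y)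

adj↗ : ∀ x y → Adj (x , suc y) (suc x , y)
adj↗ x y = Adj-intro (m≤n+m x 2) ≤-refl ≤-refl (m≤n+m y 2) (inj₁ (λ ()))

adj↙ : ∀ x y → Adj (suc x , y) (x , suc y)
adj↙ x y = Adj-sym (adj↗ x y)

-- Hamiltonian paths and cycles

lastOf : Point → List Point → Point
lastOf s []       = s
lastOf s (x ∷ xs) = lastOf x xs

lastOf-∈ : ∀ s xs → lastOf s xs ∈ s ∷ xs
lastOf-∈ s []       = here refl
lastOf-∈ s (x ∷ xs) = there (lastOf-∈ x xs)

lastOf-++ : ∀ s xs s' ys → lastOf s (xs ++ s' ∷ ys) ≡ lastOf s' ys
lastOf-++ s []       s' ys = refl
lastOf-++ s (x ∷ xs) s' ys = lastOf-++ x xs s' ys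

Consec-++ : ∀ s xs s' ys → Consec (s ∷ xs) → Consec (s' ∷ ys) → Adj (lastOf s xs) s' →
            Consec ((s ∷ xs) ++ s' ∷ ys)
Consec-++ s []       s' ys _          c' a = a , c'
Consec-++ s (x ∷ xs) s' ys (s~x , c) c' a = s~x , Consec-++ x xs s' ys c c' a

record HamiltonianPath (V : Point → Set) (s t : Point) : Set where
  constructor hamiltonianPath
  field
    rest     : List Point
    unique   : Unique (s ∷ rest)
    sound    : ∀ {p} → p ∈ s ∷ rest → V p
    complete : ∀ {p} → V p → p ∈ s ∷ rest
    consec   : Consec (s ∷ rest)
    ends     : lastOf s rest ≡ t

singletonPath : ∀ u → HamiltonianPath ｛ u ｝ u u
singletonPath u =
  hamiltonianPath [] ([] ∷ []) (λ { (here p≡u) → sym p≡u }) (λ u≡p → here (sym u≡p)) tt refl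

HamiltonianPath-cong : ∀ {V W s t} → V ≐ W → HamiltonianPath V s t → HamiltonianPath W s t
HamiltonianPath-cong (V⊆W , W⊆V) (hamiltonianPath r u sd cp co e) =
  hamiltonianPath r u (λ p∈ → V⊆W (sd p∈)) (λ w → cp (W⊆V w)) co e

joinPaths : ∀ {V W s t s' t'} → HamiltonianPath V s t → HamiltonianPath W s' t' → Adj t s' →
            Disjoint V W → HamiltonianPath (V ∪ W) s t'
joinPaths {V} {W} {s} {t} {s'} (hamiltonianPath r u sd cp co e) (hamiltonianPath r' u' sd' cp' co' e') t~s' V⊥W =
  hamiltonianPath (r ++ s' ∷ r')
    (Unique.++⁺ u u' (λ (p∈ , p∈') → V⊥W (sd p∈ , sd' p∈')))
    sound complete
    (Consec-++ s r s' r' co co' (subst (λ z → Adj z s') (sym e) t~s'))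
    (trans (lastOf-++ s r s' r') e')
  where
  sound : ∀ {p} → p ∈ (s ∷ r) ++ s' ∷ r' → V p ⊎ W p
  sound p∈ with ∈-++⁻ (s ∷ r) p∈
  ... | inj₁ p∈ˡ = inj₁ (sd p∈ˡ)
  ... | inj₂ p∈ʳ = inj₂ (sd' p∈ʳ)
  complete : ∀ {p} → V p ⊎ W p → p ∈ (s ∷ r) ++ s' ∷ r'
  complete (inj₁ v) = ∈-++⁺ˡ (cp v)
  complete (inj₂ w) = ∈-++⁺ʳ (s ∷ r) (cp' w)

module _ (f : Point → Point) {V W : Point → Set}
         (f-injective : ∀ {p q} → V p → V q → f p ≡ f q → p ≡ q)
         (f-adj : ∀ {p q} → V p → V q → Adj p q → Adj (f p) (f q))
         (f-into : ∀ {p} → V p → W (f p))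
         (f-onto : ∀ {p} → W p → ∃ λ q → V q × f q ≡ p) where

  private
    All-≢-map : ∀ x xs → V x → (∀ {p} → p ∈ xs → V p) →
                All (x ≢_) xs → All (f x ≢_) (map f xs)
    All-≢-map x []       _  _   []         = []
    All-≢-map x (y ∷ ys) vx vys (x≢y ∷ ne) =
      (λ fx≡fy → x≢y (f-injective vx (vys (here refl)) fx≡fy)) ∷ All-≢-map x ys vx (λ m → vys (there m)) ne

    Unique-map : ∀ xs → (∀ {p} → p ∈ xs → V p) → Unique xs → Unique (map f xs)
    Unique-map []       _   []       = []
    Unique-map (x ∷ xs) vxs (ne ∷ u) =
      All-≢-map x xs (vxs (here refl)) (λ m → vxs (there m)) ne ∷ Unique-map xs (λ m → vxs (there m)) u

    Consec-map : ∀ s xs → (∀ {p} → p ∈ s ∷ xs → V p) → Consec (s ∷ xs) → Consec (f s ∷ map f xs)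
    Consec-map s []       _   _         = tt
    Consec-map s (x ∷ xs) vxs (s~x , c) =
      f-adj (vxs (here refl)) (vxs (there (here refl))) s~x , Consec-map x xs (λ m → vxs (there m)) c

    lastOf-map : ∀ s xs → lastOf (f s) (map f xs) ≡ f (lastOf s xs)
    lastOf-map s []       = refl
    lastOf-map s (x ∷ xs) = lastOf-map x xs

  mapPath : ∀ {s t} → HamiltonianPath V s t → HamiltonianPath W (f s) (f t)
  mapPath {s} (hamiltonianPath r u sd cp co e) =
    hamiltonianPath (map f r) (Unique-map (s ∷ r) sd u) sound complete (Consec-map s r sd co)
      (trans (lastOf-map s r) (cong f e))
    where
    sound : ∀ {p} → p ∈ map f (s ∷ r) → W p
    sound p∈ with ∈-map⁻ f p∈
    ... | q , q∈ , refl = f-into (sd q∈)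
    complete : ∀ {p} → W p → p ∈ map f (s ∷ r)
    complete w with f-onto w
    ... | q , vq , refl = ∈-map⁺ f (cp vq)

three-distinct⇒3≤length : ∀ {p₁ p₂ p₃ : Point} xs → p₁ ∈ xs → p₂ ∈ xs → p₃ ∈ xs →
                          p₁ ≢ p₂ → p₁ ≢ p₃ → p₂ ≢ p₃ → 3 ≤ length xs
three-distinct⇒3≤length (_ ∷ _ ∷ _ ∷ _) _ _ _ _ _ _ = s≤s (s≤s (s≤s z≤n))
three-distinct⇒3≤length (_ ∷ []) (here refl) (here refl) _ ≢₁₂ _ _ = ⊥-elim (≢₁₂ refl)
three-distinct⇒3≤length (_ ∷ _ ∷ []) (here refl) (here refl) _ ≢₁₂ _ _ = ⊥-elim (≢₁₂ refl)
three-distinct⇒3≤length (_ ∷ _ ∷ []) (there (here refl)) (there (here refl)) _ ≢₁₂ _ _ = ⊥-elim (≢₁₂ refl)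
three-distinct⇒3≤length (_ ∷ _ ∷ []) (here refl) (there (here refl)) (here refl) _ ≢₁₃ _ = ⊥-elim (≢₁₃ refl)
three-distinct⇒3≤length (_ ∷ _ ∷ []) (there (here refl)) (here refl) (there (here refl)) _ ≢₁₃ _ = ⊥-elim (≢₁₃ refl)
three-distinct⇒3≤length (_ ∷ _ ∷ []) (here refl) (there (here refl)) (there (here refl)) _ _ ≢₂₃ = ⊥-elim (≢₂₃ refl)
three-distinct⇒3≤length (_ ∷ _ ∷ []) (there (here refl)) (here refl) (here refl) _ _ ≢₂₃ = ⊥-elim (≢₂₃ refl)

closePath : ∀ {V s t} → HamiltonianPath V s t → Adj t s → (p₁ p₂ p₃ : Point) → V p₁ → V p₂ → V p₃ →
            p₁ ≢ p₂ → p₁ ≢ p₃ → p₂ ≢ p₃ → HamiltonianCycle V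
closePath {s = s} (hamiltonianPath r u sd cp co e) t~s p₁ p₂ p₃ v₁ v₂ v₃ ≢₁₂ ≢₁₃ ≢₂₃ =
  s , r , u , three-distinct⇒3≤length (s ∷ r) (cp v₁) (cp v₂) (cp v₃) ≢₁₂ ≢₁₃ ≢₂₃ ,
  (λ p → mk⇔ cp sd) , Consec-++ s r s [] co tt (subst (λ z → Adj z s) (sym e) t~s)

Consec-split : ∀ xs t ys → Consec (xs ++ t ∷ ys) → Consec (xs ++ t ∷ []) × Consec (t ∷ ys)
Consec-split []            t ys c         = tt , c
Consec-split (x ∷ [])      t ys (x~t , c) = (x~t , tt) , c
Consec-split (x ∷ x' ∷ xs) t ys (x~x' , c) with Consec-split (x' ∷ xs) t ys c
... | c₁ , c₂ = (x~x' , c₁) , c₂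

Consec-join : ∀ xs t ys → Consec (xs ++ t ∷ []) → Consec (t ∷ ys) → Consec (xs ++ t ∷ ys)
Consec-join []            t ys _           c = c
Consec-join (x ∷ [])      t ys (x~t , _)   c = x~t , c
Consec-join (x ∷ x' ∷ xs) t ys (x~x' , c₁) c = x~x' , Consec-join (x' ∷ xs) t ys c₁ c

Consec-prefix : ∀ xs ys → Consec (xs ++ ys) → Consec xs
Consec-prefix []            ys _          = tt
Consec-prefix (x ∷ [])      ys _          = tt
Consec-prefix (x ∷ x' ∷ xs) ys (x~x' , c) = x~x' , Consec-prefix (x' ∷ xs) ys c

Consec-tail : ∀ s xs → Consec (s ∷ xs) → Consec xs
Consec-tail s []       _       = tt
Consec-tail s (x ∷ xs) (_ , c) = c

Consec-last : ∀ s xs t → Consec (s ∷ xs ++ t ∷ []) → Adj (lastOf s xs) t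
Consec-last s []       t (s~t , _) = s~t
Consec-last s (x ∷ xs) t (_ , c)   = Consec-last x xs t c

Consec-transport : ∀ {G T : Point → Set} → (∀ {p q} → G p → G q → Adj p q → T p → T q) →
                   ∀ xs → Consec xs → (∀ {p} → p ∈ xs → G p) → ∀ {p q} → p ∈ xs → q ∈ xs → T p → T q
Consec-transport {G} {T} step (s ∷ xs) c gs p∈ q∈ Tp = fromHead s xs c gs q∈ (toHead s xs c gs p∈ Tp)
  where
  fromHead : ∀ s xs → Consec (s ∷ xs) → (∀ {p} → p ∈ s ∷ xs → G p) → ∀ {q} → q ∈ s ∷ xs → T s → T q
  fromHead s xs       _         _  (here refl) Ts = Ts
  fromHead s (x ∷ xs) (s~x , c) gs (there q∈) Ts =
    fromHead x xs c (λ m → gs (there m)) q∈ (step (gs (here refl)) (gs (there (here refl))) s~x Ts)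
  toHead : ∀ s xs → Consec (s ∷ xs) → (∀ {p} → p ∈ s ∷ xs → G p) → ∀ {p} → p ∈ s ∷ xs → T p → T s
  toHead s xs       _         _  (here refl) Tp = Tp
  toHead s (x ∷ xs) (s~x , c) gs (there p∈) Tp =
    step (gs (there (here refl))) (gs (here refl)) (Adj-sym s~x) (toHead x xs c (λ m → gs (there m)) p∈ Tp)

HamiltonianCycleFrom : (Point → Set) → Point → Set
HamiltonianCycleFrom V u =
  Σ (List Point) λ vs → Unique (u ∷ vs) × (3 ≤ length (u ∷ vs)) × (∀ p → V p ⇔ p ∈ (u ∷ vs)) ×
    Consec ((u ∷ vs) ++ (u ∷ []))

rotateCycle : ∀ {V w} → HamiltonianCycle V → V w → HamiltonianCycleFrom V w
rotateCycle {w = w} (u , vs , uq , len , cov , c) vw with ∈-∃++ (Equivalence.to (cov w) vw)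
... | []     , ys , refl = vs , uq , len , cov , c
... | x ∷ xs , ys , refl =
  ys ++ x ∷ xs ,
  Unique-resp-↭ (↭⇒↭ₛ rotation) uq ,
  subst (3 ≤_) (↭-length rotation) len ,
  (λ p → mk⇔ (λ vp → ∈-resp-↭ rotation (Equivalence.to (cov p) vp))
             (λ p∈ → Equivalence.from (cov p) (∈-resp-↭ (↭-sym rotation) p∈))) ,
  subst Consec (sym (++-assoc (w ∷ ys) (x ∷ xs) (w ∷ []))) (Consec-join (w ∷ ys) x (xs ++ w ∷ []) w⋯x x⋯w)
  where
  x⋯w×w⋯x : Consec ((x ∷ xs) ++ w ∷ []) × Consec (w ∷ ys ++ x ∷ [])
  x⋯w×w⋯x = Consec-split (x ∷ xs) w (ys ++ x ∷ []) (subst Consec (++-assoc (x ∷ xs) (w ∷ ys) (x ∷ [])) c)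
  x⋯w : Consec ((x ∷ xs) ++ w ∷ [])
  x⋯w = proj₁ x⋯w×w⋯x
  w⋯x : Consec (w ∷ ys ++ x ∷ [])
  w⋯x = proj₂ x⋯w×w⋯x
  rotation : (x ∷ xs) ++ w ∷ ys ↭ w ∷ ys ++ x ∷ xs
  rotation = ++-comm (x ∷ xs) (w ∷ ys)

cycle-twoNeighbours : ∀ {V w} → HamiltonianCycleFrom V w →
                      ∃ λ p → ∃ λ q → V p × V q × p ≢ q × Adj w p × Adj w q
cycle-twoNeighbours (y ∷ y' ∷ ys , uq@(_ ∷ y∉ ∷ _) , _ , cov , c) =
  y , lastOf y' ys , Equivalence.from (cov y) (there (here refl)) ,
  Equivalence.from (cov _) (there (there (lastOf-∈ y' ys))) ,
  All.lookup y∉ (lastOf-∈ y' ys) ,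
  proj₁ c , Adj-sym (Consec-last y' ys _ (proj₂ (proj₂ c)))
cycle-twoNeighbours ([]     , _ , s≤s ()       , _)
cycle-twoNeighbours (_ ∷ [] , _ , s≤s (s≤s ()) , _)

-- Paths in rectangles

Box : ℕ → ℕ → ℕ → ℕ → Point → Set
Box x₀ x₁ y₀ y₁ (x , y) = x₀ ≤ x × x ≤ x₁ × y₀ ≤ y × y ≤ y₁

Box-point : ∀ {x y} → Box x x y y ≐ ｛ (x , y) ｝
Box-point = (λ { {x , y} (x≤ , ≤x , y≤ , ≤y) → sym (cong₂ _,_ (≤-antisym ≤x x≤) (≤-antisym ≤y y≤)) })
          , (λ { refl → ≤-refl , ≤-refl , ≤-refl , ≤-refl })

Box-splitX : ∀ {x₀ x x₁ y₀ y₁} → x₀ ≤ suc x → x ≤ x₁ →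
             Box x₀ x₁ y₀ y₁ ≐ Box x₀ x y₀ y₁ ∪ Box (suc x) x₁ y₀ y₁
Box-splitX {x = x} x₀≤ ≤x₁ = split , join
  where
  split : Box _ _ _ _ ⊆ Box _ _ _ _ ∪ Box _ _ _ _
  split {p , _} (a , b , c , d) with p ≤? x
  ... | yes p≤x = inj₁ (a , p≤x , c , d)
  ... | no  p≰x = inj₂ (≰⇒> p≰x , b , c , d)
  join : Box _ _ _ _ ∪ Box _ _ _ _ ⊆ Box _ _ _ _
  join {_ , _} (inj₁ (a , b , c , d)) = a , ≤-trans b ≤x₁ , c , d
  join {_ , _} (inj₂ (a , b , c , d)) = ≤-trans x₀≤ a , b , c , d

Box-splitY : ∀ {x₀ x₁ y₀ y y₁} → y₀ ≤ suc y → y ≤ y₁ →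
             Box x₀ x₁ y₀ y₁ ≐ Box x₀ x₁ y₀ y ∪ Box x₀ x₁ (suc y) y₁
Box-splitY {y = y} y₀≤ ≤y₁ = split , join
  where
  split : Box _ _ _ _ ⊆ Box _ _ _ _ ∪ Box _ _ _ _
  split {_ , q} (a , b , c , d) with q ≤? y
  ... | yes q≤y = inj₁ (a , b , c , q≤y)
  ... | no  q≰y = inj₂ (a , b , ≰⇒> q≰y , d)
  join : Box _ _ _ _ ∪ Box _ _ _ _ ⊆ Box _ _ _ _
  join {_ , _} (inj₁ (a , b , c , d)) = a , b , c , ≤-trans d ≤y₁
  join {_ , _} (inj₂ (a , b , c , d)) = a , b , ≤-trans y₀≤ c , d

Box-disjointX : ∀ {x₀ m x₁ y₀ y₁ y₀' y₁'} → Disjoint (Box x₀ m y₀ y₁) (Box (suc m) x₁ y₀' y₁')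
Box-disjointX {x = _ , _} ((_ , p≤m , _) , (m<p , _)) = <⇒≱ m<p p≤m

Box-disjointY : ∀ {x₀ x₁ y₀ m x₀' x₁' y₁} → Disjoint (Box x₀ x₁ y₀ m) (Box x₀' x₁' (suc m) y₁)
Box-disjointY {x = _ , _} ((_ , _ , _ , q≤m) , (_ , _ , m<q , _)) = <⇒≱ m<q q≤m

Box-mono : ∀ {x₀ x₁ y₀ y₁ x₀' x₁' y₀' y₁'} → x₀' ≤ x₀ → x₁ ≤ x₁' → y₀' ≤ y₀ → y₁ ≤ y₁' →
           Box x₀ x₁ y₀ y₁ ⊆ Box x₀' x₁' y₀' y₁'
Box-mono h₁ h₂ h₃ h₄ {_ , _} (a , b , c , d) = ≤-trans h₁ a , ≤-trans b h₂ , ≤-trans h₃ c , ≤-trans d h₄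

pointPath : ∀ x y → HamiltonianPath (Box x x y y) (x , y) (x , y)
pointPath x y = HamiltonianPath-cong (≐-sym Box-point) (singletonPath (x , y))

beside : ∀ {x₀ x x₁ y₀ y₁ s t s' t'} → x₀ ≤ suc x → x ≤ x₁ →
         HamiltonianPath (Box x₀ x y₀ y₁) s t → HamiltonianPath (Box (suc x) x₁ y₀ y₁) s' t' → Adj t s' →
         HamiltonianPath (Box x₀ x₁ y₀ y₁) s t'
beside x₀≤ ≤x₁ P Q t~s' = HamiltonianPath-cong (≐-sym (Box-splitX x₀≤ ≤x₁)) (joinPaths P Q t~s' Box-disjointX)

below : ∀ {x₀ x₁ y₀ y y₁ s t s' t'} → y₀ ≤ suc y → y ≤ y₁ →
        HamiltonianPath (Box x₀ x₁ y₀ y) s t → HamiltonianPath (Box x₀ x₁ (suc y) y₁) s' t' → Adj t s' →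
        HamiltonianPath (Box x₀ x₁ y₀ y₁) s t'
below y₀≤ ≤y₁ P Q t~s' = HamiltonianPath-cong (≐-sym (Box-splitY y₀≤ ≤y₁)) (joinPaths P Q t~s' Box-disjointY)

transpose : Point → Point
transpose (x , y) = (y , x)

transposeBox : ∀ {x₀ x₁ y₀ y₁ s t} → HamiltonianPath (Box x₀ x₁ y₀ y₁) s t →
               HamiltonianPath (Box y₀ y₁ x₀ x₁) (transpose s) (transpose t)
transposeBox = mapPath transpose injective adj into onto
  where
  injective : ∀ {p q} → _ → _ → transpose p ≡ transpose q → p ≡ q
  injective {_ , _} {_ , _} _ _ refl = refl
  adj : ∀ {p q} → _ → _ → Adj p q → Adj (transpose p) (transpose q)
  adj {_ , _} {_ , _} _ _ (p≢q , near-x , near-y) = (λ { refl → p≢q refl }) , near-y , near-x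
  into : Box _ _ _ _ ⊆ (λ p → Box _ _ _ _ (transpose p))
  into {_ , _} (a , b , c , d) = c , d , a , b
  onto : ∀ {p} → Box _ _ _ _ p → ∃ λ q → Box _ _ _ _ q × transpose q ≡ p
  onto {x , y} (a , b , c , d) = (y , x) , (c , d , a , b) , refl

reflectX : ℕ → Point → Point
reflectX K (x , y) = (K ∸ x , y)

x≤1+y⇒K∸y≤1+[K∸x] : ∀ K x y → x ≤ suc y → K ∸ y ≤ suc (K ∸ x)
x≤1+y⇒K∸y≤1+[K∸x] zero    x       y       _ = subst (_≤ suc (0 ∸ x)) (sym (0∸n≡0 y)) z≤n
x≤1+y⇒K∸y≤1+[K∸x] (suc K) zero    zero    _ = n≤1+n _
x≤1+y⇒K∸y≤1+[K∸x] (suc K) zero    (suc y) _ = ≤-trans (m∸n≤m K y) (m≤n+m K 2)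
x≤1+y⇒K∸y≤1+[K∸x] (suc K) (suc zero) zero _ = ≤-refl
x≤1+y⇒K∸y≤1+[K∸x] (suc K) (suc x) (suc y) (s≤s h) = x≤1+y⇒K∸y≤1+[K∸x] K x y h

mirrorX : ∀ {x₀ x₁ y₀ y₁ s t} → HamiltonianPath (Box x₀ x₁ y₀ y₁) s t →
          HamiltonianPath (Box x₀ x₁ y₀ y₁) (reflectX (x₀ + x₁) s) (reflectX (x₀ + x₁) t)
mirrorX {x₀} {x₁} = mapPath (reflectX K) injective adj into onto
  where
  K : ℕ
  K = x₀ + x₁
  ≤K : ∀ {x} → x ≤ x₁ → x ≤ K
  ≤K x≤ = ≤-trans x≤ (m≤n+m x₁ x₀)
  injective : ∀ {p q} → Box _ _ _ _ p → Box _ _ _ _ q → reflectX K p ≡ reflectX K q → p ≡ q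
  injective {_ , _} {_ , _} (_ , b , _) (_ , b' , _) e =
    cong₂ _,_ (∸-cancelˡ-≡ (≤K b) (≤K b') (cong proj₁ e)) (cong proj₂ e)
  adj : ∀ {p q} → Box _ _ _ _ p → Box _ _ _ _ q → Adj p q → Adj (reflectX K p) (reflectX K q)
  adj {x , _} {x' , _} vp vq (p≢q , near-x , near-y) =
    (λ e → p≢q (injective vp vq e)) ,
    m≤1+n⇒n≤1+m⇒∣m-n∣≤1 (K ∸ x) (K ∸ x')
      (x≤1+y⇒K∸y≤1+[K∸x] K x' x (∣m-n∣≤1⇒m≤1+n x' x (∣m-n∣≤1⇒∣n-m∣≤1 x x' near-x)))
      (x≤1+y⇒K∸y≤1+[K∸x] K x x' (∣m-n∣≤1⇒m≤1+n x x' near-x)) ,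
    near-y
  K∸-inBox : ∀ {x} → x₀ ≤ x → x ≤ x₁ → x₀ ≤ K ∸ x × K ∸ x ≤ x₁
  K∸-inBox {x} a b =
    m+n≤o⇒m≤o∸n x₀ (+-monoʳ-≤ x₀ b) , m≤n+o⇒m∸n≤o K x (+-monoˡ-≤ x₁ a)
  into : Box _ _ _ _ ⊆ (λ p → Box _ _ _ _ (reflectX K p))
  into {_ , _} (a , b , c , d) = proj₁ (K∸-inBox a b) , proj₂ (K∸-inBox a b) , c , d
  onto : ∀ {p} → Box _ _ _ _ p → ∃ λ q → Box _ _ _ _ q × reflectX K q ≡ p
  onto {x , y} (a , b , c , d) =
    (K ∸ x , y) , (proj₁ (K∸-inBox a b) , proj₂ (K∸-inBox a b) , c , d) , cong (_, y) (m∸[m∸n]≡n (≤K b))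

mirrorY : ∀ {x₀ x₁ y₀ y₁ s t} → HamiltonianPath (Box x₀ x₁ y₀ y₁) s t →
          HamiltonianPath (Box x₀ x₁ y₀ y₁) (transpose (reflectX (y₀ + y₁) (transpose s)))
                                            (transpose (reflectX (y₀ + y₁) (transpose t)))
mirrorY P = transposeBox (mirrorX (transposeBox P))

reflectX-left : ∀ x₀ x₁ y → reflectX (x₀ + x₁) (x₀ , y) ≡ (x₁ , y)
reflectX-left x₀ x₁ y = cong (_, y) (m+n∸m≡n x₀ x₁)

reflectX-right : ∀ x₀ x₁ y → reflectX (x₀ + x₁) (x₁ , y) ≡ (x₀ , y)
reflectX-right x₀ x₁ y = cong (_, y) (m+n∸n≡m x₀ x₁)

rowRight : ∀ {x₀} x₁ y → x₀ ≤ x₁ → HamiltonianPath (Box x₀ x₁ y y) (x₀ , y) (x₁ , y)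
rowRight {x₀} x₁ y x₀≤x₁ with m≤n⇒m<n∨m≡n x₀≤x₁
... | inj₂ refl      = pointPath x₀ y
... | inj₁ (s≤s x₀≤x) =
  beside (m≤n⇒m≤1+n x₀≤x) (n≤1+n _) (rowRight _ y x₀≤x) (pointPath _ y) (adj→ _ y)

rowLeft : ∀ {x₀} x₁ y → x₀ ≤ x₁ → HamiltonianPath (Box x₀ x₁ y y) (x₁ , y) (x₀ , y)
rowLeft {x₀} x₁ y x₀≤x₁ =
  subst₂ (HamiltonianPath _) (reflectX-left x₀ x₁ y) (reflectX-right x₀ x₁ y) (mirrorX (rowRight x₁ y x₀≤x₁))

columnDown : ∀ x {y₀ y₁} → y₀ ≤ y₁ → HamiltonianPath (Box x x y₀ y₁) (x , y₀) (x , y₁)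
columnDown x {y₁ = y₁} y₀≤y₁ = transposeBox (rowRight y₁ x y₀≤y₁)

columnUp : ∀ x {y₀ y₁} → y₀ ≤ y₁ → HamiltonianPath (Box x x y₀ y₁) (x , y₁) (x , y₀)
columnUp x {y₁ = y₁} y₀≤y₁ = transposeBox (rowLeft y₁ x y₀≤y₁)

zigzagRight : ∀ {x₀} x₁ y → x₀ ≤ x₁ → HamiltonianPath (Box x₀ x₁ y (suc y)) (x₀ , y) (x₁ , suc y)
zigzagRight {x₀} x₁ y x₀≤x₁ with m≤n⇒m<n∨m≡n x₀≤x₁
... | inj₂ refl      = columnDown x₀ (n≤1+n y)
... | inj₁ (s≤s x₀≤x) =
  beside (m≤n⇒m≤1+n x₀≤x) (n≤1+n _) (zigzagRight _ y x₀≤x) (columnDown _ (n≤1+n y)) (adj↗ _ y)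

zigzagLeft : ∀ {x₀} x₁ y → x₀ ≤ x₁ → HamiltonianPath (Box x₀ x₁ y (suc y)) (x₁ , y) (x₀ , suc y)
zigzagLeft {x₀} x₁ y x₀≤x₁ =
  subst₂ (HamiltonianPath _) (reflectX-left x₀ x₁ y) (reflectX-right x₀ x₁ (suc y))
    (mirrorX (zigzagRight x₁ y x₀≤x₁))

-- The last row is written suc h + y₀, which reduces to suc (h + y₀), so peeling two rows off the
-- bottom needs no arithmetic; three rows are a row followed by a zigzag.
snake : ∀ {x₀ x₁} y₀ h → x₀ ≤ x₁ → HamiltonianPath (Box x₀ x₁ y₀ (suc h + y₀)) (x₀ , y₀) (x₀ , suc h + y₀)
snake {x₁ = x₁} y₀ zero x₀≤x₁ =
  below (n≤1+n y₀) (n≤1+n y₀) (rowRight x₁ y₀ x₀≤x₁) (rowLeft x₁ (suc y₀) x₀≤x₁) (adj↓ x₁ y₀)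
snake {x₁ = x₁} y₀ (suc zero) x₀≤x₁ =
  below (n≤1+n y₀) (m≤n+m y₀ 2) (rowRight x₁ y₀ x₀≤x₁) (zigzagLeft x₁ (suc y₀) x₀≤x₁) (adj↓ x₁ y₀)
snake {x₀} {x₁} y₀ (suc (suc h)) x₀≤x₁ =
  below (m≤n+m y₀ (suc (suc h))) (m≤n+m Y 2) (snake y₀ h x₀≤x₁)
        (below (n≤1+n _) (n≤1+n _) (rowRight x₁ (suc Y) x₀≤x₁) (rowLeft x₁ (suc (suc Y)) x₀≤x₁) (adj↓ x₁ (suc Y)))
        (adj↓ x₀ Y)
  where
  Y : ℕ
  Y = suc h + y₀

snakeTL→BL : ∀ {x₀ x₁ y₀ y₁} → x₀ ≤ x₁ → y₀ ≤ y₁ → x₀ ≡ x₁ ⊎ y₀ < y₁ →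
             HamiltonianPath (Box x₀ x₁ y₀ y₁) (x₀ , y₀) (x₀ , y₁)
snakeTL→BL {x₀} _ y₀≤y₁ (inj₁ refl) = columnDown x₀ y₀≤y₁
snakeTL→BL {x₀} {x₁} {y₀} {y₁} x₀≤x₁ _ (inj₂ y₀<y₁) =
  subst (λ y → HamiltonianPath (Box x₀ x₁ y₀ y) (x₀ , y₀) (x₀ , y)) height (snake y₀ (y₁ ∸ suc y₀) x₀≤x₁)
  where
  height : suc (y₁ ∸ suc y₀ + y₀) ≡ y₁
  height = trans (sym (+-suc (y₁ ∸ suc y₀) y₀)) (m∸n+n≡m y₀<y₁)

snakeTL→TR : ∀ {x₀ x₁ y₀ y₁} → x₀ ≤ x₁ → y₀ ≤ y₁ → y₀ ≡ y₁ ⊎ x₀ < x₁ →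
             HamiltonianPath (Box x₀ x₁ y₀ y₁) (x₀ , y₀) (x₁ , y₀)
snakeTL→TR x₀≤x₁ y₀≤y₁ thin = transposeBox (snakeTL→BL y₀≤y₁ x₀≤x₁ thin)

snakeTR→BR : ∀ {x₀ x₁ y₀ y₁} → x₀ ≤ x₁ → y₀ ≤ y₁ → x₀ ≡ x₁ ⊎ y₀ < y₁ →
             HamiltonianPath (Box x₀ x₁ y₀ y₁) (x₁ , y₀) (x₁ , y₁)
snakeTR→BR {x₀} {x₁} {y₀} {y₁} x₀≤x₁ y₀≤y₁ thin =
  subst₂ (HamiltonianPath _) (reflectX-left x₀ x₁ y₀) (reflectX-left x₀ x₁ y₁)
    (mirrorX (snakeTL→BL x₀≤x₁ y₀≤y₁ thin))

snakeBR→BL : ∀ {x₀ x₁ y₀ y₁} → x₀ ≤ x₁ → y₀ ≤ y₁ → y₀ ≡ y₁ ⊎ x₀ < x₁ →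
             HamiltonianPath (Box x₀ x₁ y₀ y₁) (x₁ , y₁) (x₀ , y₁)
snakeBR→BL {x₀} {x₁} {y₀} {y₁} x₀≤x₁ y₀≤y₁ thin =
  subst₂ (HamiltonianPath _) (cong₂ _,_ (m+n∸m≡n x₀ x₁) (m+n∸m≡n y₀ y₁))
                             (cong₂ _,_ (m+n∸n≡m x₀ x₁) (m+n∸m≡n y₀ y₁))
    (mirrorY (mirrorX (snakeTL→TR x₀≤x₁ y₀≤y₁ thin)))

-- A Hamiltonian cycle of the C-shape

TopArm : ℕ → ℕ → ℕ → Point → Set
TopArm a m c = Box 2 a 1 c ∪ Box (suc a) m 1 c

Middle : ℕ → ℕ → ℕ → Point → Set
Middle a c l = Box 2 a (suc c) (c + l)

BottomArm : ℕ → ℕ → ℕ → ℕ → Point → Set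
BottomArm a m n h = Box 2 a (suc h) n ∪ Box (suc a) m (suc h) n

-- The C-shape without its first column x = 1, where a stands for m ∸ k.
Body : ℕ → ℕ → ℕ → ℕ → ℕ → Point → Set
Body a m n c l = TopArm a m c ∪ (Middle a c l ∪ BottomArm a m n (c + l))

Middle-disjoint-BottomArm : ∀ {a m n c l} → Disjoint (Middle a c l) (BottomArm a m n (c + l))
Middle-disjoint-BottomArm {x = _ , _} (middle , inj₁ bottom) = Box-disjointY (middle , bottom)
Middle-disjoint-BottomArm {x = _ , _} (middle , inj₂ bottom) = Box-disjointY (middle , bottom)

joinLower : ∀ {a m n c l s t s' t'} → HamiltonianPath (Middle a c l) s t → HamiltonianPath (BottomArm a m n (c + l)) s' t' →
            Adj t s' → HamiltonianPath (Middle a c l ∪ BottomArm a m n (c + l)) s t'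
joinLower P Q t~s' = joinPaths P Q t~s' Middle-disjoint-BottomArm

TopArm-disjoint-Lower : ∀ {a m n c l} → Disjoint (TopArm a m c) (Middle a c l ∪ BottomArm a m n (c + l))
TopArm-disjoint-Lower {c = c} {l} {x = _ , _} (top , lower) = <⇒≱ (c<y lower) (y≤c top)
  where
  y≤c : ∀ {a m x y} → TopArm a m c (x , y) → y ≤ c
  y≤c (inj₁ (_ , _ , _ , y≤c)) = y≤c
  y≤c (inj₂ (_ , _ , _ , y≤c)) = y≤c
  c<y : ∀ {a m n x y} → (Middle a c l ∪ BottomArm a m n (c + l)) (x , y) → c < y
  c<y (inj₁ (_ , _ , c<y , _))         = c<y
  c<y (inj₂ (inj₁ (_ , _ , cl<y , _))) = ≤-trans (s≤s (m≤m+n c l)) cl<y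
  c<y (inj₂ (inj₂ (_ , _ , cl<y , _))) = ≤-trans (s≤s (m≤m+n c l)) cl<y

joinBody : ∀ {a m n c l s t s' t'} → HamiltonianPath (TopArm a m c) s t →
           HamiltonianPath (Middle a c l ∪ BottomArm a m n (c + l)) s' t' → Adj t s' → HamiltonianPath (Body a m n c l) s t'
joinBody P Q t~s' = joinPaths P Q t~s' TopArm-disjoint-Lower

topArm-toCorner : ∀ {a m c} → 2 ≤ a → suc a ≤ m → 1 ≤ c → c ≡ 1 ⊎ 2 < a → suc a ≡ m ⊎ 1 < c →
                  HamiltonianPath (TopArm a m c) (2 , 1) (suc a , c)
topArm-toCorner 2≤a a<m 1≤c thinLeft thinRight =
  joinPaths (snakeTL→TR 2≤a 1≤c (map₁ sym thinLeft)) (snakeTL→BL a<m 1≤c thinRight) (adj→ _ 1) Box-disjointX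

topArm-toLeft : ∀ {a m c} → 2 ≤ a → suc a ≤ m → 1 < c → HamiltonianPath (TopArm a m c) (2 , 1) (2 , c)
topArm-toLeft 2≤a a<m 1<c =
  HamiltonianPath-cong (Box-splitX (m≤n⇒m≤1+n 2≤a) (<⇒≤ a<m))
    (snakeTL→BL (≤-trans 2≤a (<⇒≤ a<m)) (<⇒≤ 1<c) (inj₂ 1<c))

middle-alongRight : ∀ {a c l} → 2 ≤ a → 1 ≤ l → 2 ≡ a ⊎ suc c < c + l →
                    HamiltonianPath (Middle a c l) (a , suc c) (a , c + l)
middle-alongRight {c = c} 2≤a 1≤l thin = snakeTR→BR 2≤a (m<m+n c 1≤l) thin

middleRow-leftward : ∀ {a c} → 2 ≤ a → HamiltonianPath (Middle a c 1) (a , suc c) (2 , c + 1)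
middleRow-leftward {a} {c} 2≤a =
  subst (λ y → HamiltonianPath (Box 2 a (suc c) y) (a , suc c) (2 , y)) (+-comm 1 c) (rowLeft a (suc c) 2≤a)

middleRow-rightward : ∀ {a c} → 2 ≤ a → HamiltonianPath (Middle a c 1) (2 , suc c) (a , c + 1)
middleRow-rightward {a} {c} 2≤a =
  subst (λ y → HamiltonianPath (Box 2 a (suc c) y) (2 , suc c) (a , y)) (+-comm 1 c) (rowRight a (suc c) 2≤a)

bottomArm-fromCorner : ∀ {a m n h} → 2 ≤ a → suc a ≤ m → suc h ≤ n → suc h ≡ n ⊎ 2 < a → suc a ≡ m ⊎ suc h < n →
                       HamiltonianPath (BottomArm a m n h) (suc a , suc h) (2 , n)
bottomArm-fromCorner {a} {n = n} 2≤a a<m h<n thinLeft thinRight =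
  HamiltonianPath-cong (swap , swap)
    (joinPaths (snakeTL→BL a<m h<n thinRight) (snakeBR→BL 2≤a h<n thinLeft) (adj← a n)
               λ { {_ , _} (right , left) → Box-disjointX (left , right) })

bottomArm-fromLeft : ∀ {a m n h} → 2 ≤ a → suc a ≤ m → suc h < n → HamiltonianPath (BottomArm a m n h) (2 , suc h) (2 , n)
bottomArm-fromLeft 2≤a a<m h<n =
  HamiltonianPath-cong (Box-splitX (m≤n⇒m≤1+n 2≤a) (<⇒≤ a<m))
    (snakeTL→BL (≤-trans 2≤a (<⇒≤ a<m)) (<⇒≤ h<n) (inj₂ h<n))

bodyPath-a≡2 : ∀ {m n c l} → 3 ≤ m → suc (c + l) ≤ n → 1 ≤ c → 1 ≤ l → 3 ≡ m ⊎ 1 < c → 3 ≡ m ⊎ suc (c + l) < n →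
               HamiltonianPath (Body 2 m n c l) (2 , 1) (2 , n)
bodyPath-a≡2 {m} {n} {c} {l} 3≤m cl<n 1≤c 1≤l topOK bottomOK = assemble top bottom
  where
  top : ∃ λ t → HamiltonianPath (TopArm 2 m c) (2 , 1) t × Adj t (2 , suc c)
  top with m≤n⇒m<n∨m≡n 1≤c
  ... | inj₂ refl = _ , topArm-toCorner ≤-refl 3≤m ≤-refl (inj₁ refl) topOK , adj↙ 2 1
  ... | inj₁ 1<c  = _ , topArm-toLeft ≤-refl 3≤m 1<c , adj↓ 2 c
  bottom : ∃ λ s → HamiltonianPath (BottomArm 2 m n (c + l)) s (2 , n) × Adj (2 , c + l) s
  bottom with m≤n⇒m<n∨m≡n cl<n
  ... | inj₂ d≡1  = _ , bottomArm-fromCorner ≤-refl 3≤m cl<n (inj₁ d≡1) bottomOK , adj↘ 2 (c + l)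
  ... | inj₁ 1<d  = _ , bottomArm-fromLeft ≤-refl 3≤m 1<d , adj↓ 2 (c + l)
  assemble : (∃ λ t → HamiltonianPath (TopArm 2 m c) (2 , 1) t × Adj t (2 , suc c)) →
             (∃ λ s → HamiltonianPath (BottomArm 2 m n (c + l)) s (2 , n) × Adj (2 , c + l) s) →
             HamiltonianPath (Body 2 m n c l) (2 , 1) (2 , n)
  assemble (_ , P , t~) (_ , Q , ~s) = joinBody P (joinLower (middle-alongRight ≤-refl 1≤l (inj₁ refl)) Q ~s) t~

bodyPath-2≤l : ∀ {a m n c l} → 2 < a → suc a ≤ m → suc (c + l) ≤ n → 1 ≤ c → 1 < l →
               suc a ≡ m ⊎ 1 < c → suc a ≡ m ⊎ suc (c + l) < n → HamiltonianPath (Body a m n c l) (2 , 1) (2 , n)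
bodyPath-2≤l {a} {c = c} {l} 2<a a<m cl<n 1≤c 1<l topOK bottomOK =
  joinBody (topArm-toCorner (<⇒≤ 2<a) a<m 1≤c (inj₂ 2<a) topOK)
    (joinLower (middle-alongRight (<⇒≤ 2<a) (<⇒≤ 1<l) (inj₂ (subst (_≤ c + l) (+-comm c 2) (+-monoʳ-≤ c 1<l))))
               (bottomArm-fromCorner (<⇒≤ 2<a) a<m cl<n (inj₂ 2<a) bottomOK)
               (adj↘ a (c + l)))
    (adj↙ a c)

-- The only C-shape with a ≥ 2 and no vertex of degree one in which the generic schemes fail:
-- both corners (a+1, 1) and (a+1, 3) force the path through (a, 2).
bodyPath-exceptional : ∀ {a} → 2 < a → HamiltonianPath (Body a (suc a) 3 1 1) (2 , 1) (2 , 3)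
bodyPath-exceptional {suc b} (s≤s 2≤b) =
  joinBody (topArm-toCorner (m≤n⇒m≤1+n 2≤b) ≤-refl ≤-refl (inj₁ refl) (inj₁ refl))
    (HamiltonianPath-cong hook≐lower
      (joinPaths (pointPath (suc b) 2)
                 (joinPaths (rowLeft (suc (suc b)) 3 (n≤1+n _)) (zigzagLeft b 2 2≤b) (adj↖ b 2)
                            λ { {_ , _} (right , left) → Box-disjointX (left , right) })
                 (adj↘ (suc b) 2)
                 λ { {_ , _} (p , inj₁ q) → Box-disjointY (p , q)
                   ; {_ , _} (p , inj₂ q) → Box-disjointX (q , p) }))
    (adj↙ (suc b) 1)
  where
  hook≐lower : Box (suc b) (suc b) 2 2 ∪ (Box (suc b) (suc (suc b)) 3 3 ∪ Box 2 b 2 3)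
               ≐ Middle (suc b) 1 1 ∪ BottomArm (suc b) (suc (suc b)) 3 2
  hook≐lower = to , from
    where
    to : Box (suc b) (suc b) 2 2 ∪ (Box (suc b) (suc (suc b)) 3 3 ∪ Box 2 b 2 3)
         ⊆ Middle (suc b) 1 1 ∪ BottomArm (suc b) (suc (suc b)) 3 2
    to (inj₁ p) = inj₁ (Box-mono (m≤n⇒m≤1+n 2≤b) ≤-refl ≤-refl ≤-refl p)
    to (inj₂ (inj₁ p)) with proj₁ (Box-splitX {x = suc b} (n≤1+n _) (n≤1+n _)) p
    ... | inj₁ q = inj₂ (inj₁ (Box-mono (m≤n⇒m≤1+n 2≤b) ≤-refl ≤-refl ≤-refl q))
    ... | inj₂ q = inj₂ (inj₂ q)
    to (inj₂ (inj₂ p)) with proj₁ (Box-splitY {y = 2} (n≤1+n _) (n≤1+n _)) p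
    ... | inj₁ q = inj₁ (Box-mono ≤-refl (n≤1+n b) ≤-refl ≤-refl q)
    ... | inj₂ q = inj₂ (inj₁ (Box-mono ≤-refl (n≤1+n b) ≤-refl ≤-refl q))
    from : Middle (suc b) 1 1 ∪ BottomArm (suc b) (suc (suc b)) 3 2
           ⊆ Box (suc b) (suc b) 2 2 ∪ (Box (suc b) (suc (suc b)) 3 3 ∪ Box 2 b 2 3)
    from (inj₁ p) with proj₁ (Box-splitX {x = b} (m≤n⇒m≤1+n 2≤b) (n≤1+n _)) p
    ... | inj₁ q = inj₂ (inj₂ (Box-mono ≤-refl ≤-refl ≤-refl (n≤1+n 2) q))
    ... | inj₂ q = inj₁ q
    from (inj₂ (inj₁ p)) with proj₁ (Box-splitX {x = b} (m≤n⇒m≤1+n 2≤b) (n≤1+n _)) p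
    ... | inj₁ q = inj₂ (inj₂ (Box-mono ≤-refl ≤-refl (n≤1+n 2) ≤-refl q))
    ... | inj₂ q = inj₂ (inj₁ (Box-mono ≤-refl (n≤1+n _) ≤-refl ≤-refl q))
    from (inj₂ (inj₂ p)) = inj₂ (inj₁ (Box-mono (n≤1+n _) ≤-refl ≤-refl ≤-refl p))

bodyPath-l≡1 : ∀ {a m n c} → 2 < a → suc a ≤ m → suc (c + 1) ≤ n → 1 ≤ c →
               suc a ≡ m ⊎ 1 < c → suc a ≡ m ⊎ suc (c + 1) < n → HamiltonianPath (Body a m n c 1) (2 , 1) (2 , n)
bodyPath-l≡1 {a} {c = c} 2<a a<m cl<n 1≤c topOK bottomOK with m≤n⇒m<n∨m≡n cl<n | m≤n⇒m<n∨m≡n 1≤c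
... | inj₁ 1<d | _ =
  joinBody (topArm-toCorner (<⇒≤ 2<a) a<m 1≤c (inj₂ 2<a) topOK)
    (joinLower (middleRow-leftward (<⇒≤ 2<a)) (bottomArm-fromLeft (<⇒≤ 2<a) a<m 1<d) (adj↓ 2 (c + 1)))
    (adj↙ a c)
... | inj₂ refl | inj₁ 1<c =
  joinBody (topArm-toLeft (<⇒≤ 2<a) a<m 1<c)
    (joinLower (middleRow-rightward (<⇒≤ 2<a))
               (bottomArm-fromCorner (<⇒≤ 2<a) a<m cl<n (inj₂ 2<a) bottomOK) (adj↘ a (c + 1)))
    (adj↓ 2 c)
... | inj₂ refl | inj₂ refl with topOK
...   | inj₁ refl = bodyPath-exceptional 2<a
...   | inj₂ (s≤s ())

-- The disjunctions say that the corners (m, 1) and (m, n) do not have degree one (suc a ≡ m means k = 1).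
bodyPath : ∀ {a m n c l} → 2 ≤ a → suc a ≤ m → suc (c + l) ≤ n → 1 ≤ c → 1 ≤ l →
           suc a ≡ m ⊎ 1 < c → suc a ≡ m ⊎ suc (c + l) < n → HamiltonianPath (Body a m n c l) (2 , 1) (2 , n)
bodyPath 2≤a a<m cl<n 1≤c 1≤l topOK bottomOK with m≤n⇒m<n∨m≡n 2≤a | m≤n⇒m<n∨m≡n 1≤l
... | inj₂ refl | _         = bodyPath-a≡2 a<m cl<n 1≤c 1≤l topOK bottomOK
... | inj₁ 2<a  | inj₁ 1<l  = bodyPath-2≤l 2<a a<m cl<n 1≤c 1<l topOK bottomOK
... | inj₁ 2<a  | inj₂ refl = bodyPath-l≡1 2<a a<m cl<n 1≤c topOK bottomOK

InC≐Body∪column : ∀ {m n k l c} → 1 ≤ m ∸ k → c + l ≤ n → InC m n k l c ≐ Body (m ∸ k) m n c l ∪ Box 1 1 1 n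
InC≐Body∪column {m} {n} {k} {l} {c} 1≤a c+l≤n = classify , inC
  where
  a : ℕ
  a = m ∸ k
  classify : InC m n k l c ⊆ Body a m n c l ∪ Box 1 1 1 n
  classify {x , y} (1≤x , x≤m , 1≤y , y≤n , notHole) with x ≤? 1 | y ≤? c | y ≤? c + l | x ≤? a
  ... | yes x≤1 | _       | _        | _       = inj₂ (1≤x , x≤1 , 1≤y , y≤n)
  ... | no  x≰1 | yes y≤c | _        | yes x≤a = inj₁ (inj₁ (inj₁ (≰⇒> x≰1 , x≤a , 1≤y , y≤c)))
  ... | no  _   | yes y≤c | _        | no  x≰a = inj₁ (inj₁ (inj₂ (≰⇒> x≰a , x≤m , 1≤y , y≤c)))
  ... | no  x≰1 | no  y≰c | yes y≤cl | yes x≤a = inj₁ (inj₂ (inj₁ (≰⇒> x≰1 , x≤a , ≰⇒> y≰c , y≤cl)))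
  ... | no  _   | no  y≰c | yes y≤cl | no  x≰a = ⊥-elim (notHole (≰⇒> x≰a , ≰⇒> y≰c , y≤cl))
  ... | no  x≰1 | no  _   | no  y≰cl | yes x≤a = inj₁ (inj₂ (inj₂ (inj₁ (≰⇒> x≰1 , x≤a , ≰⇒> y≰cl , y≤n))))
  ... | no  _   | no  _   | no  y≰cl | no  x≰a = inj₁ (inj₂ (inj₂ (inj₂ (≰⇒> x≰a , x≤m , ≰⇒> y≰cl , y≤n))))
  a≤m : a ≤ m
  a≤m = m∸n≤m m k
  c≤n : c ≤ n
  c≤n = ≤-trans (m≤m+n c l) c+l≤n
  inC : Body a m n c l ∪ Box 1 1 1 n ⊆ InC m n k l c
  inC {_ , _} (inj₁ (inj₁ (inj₁ (2≤x , x≤a , 1≤y , y≤c)))) =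
    ≤-trans (n≤1+n 1) 2≤x , ≤-trans x≤a a≤m , 1≤y , ≤-trans y≤c c≤n , λ (_ , c<y , _) → <⇒≱ c<y y≤c
  inC {_ , _} (inj₁ (inj₁ (inj₂ (a<x , x≤m , 1≤y , y≤c)))) =
    ≤-trans (s≤s z≤n) a<x , x≤m , 1≤y , ≤-trans y≤c c≤n , λ (_ , c<y , _) → <⇒≱ c<y y≤c
  inC {_ , _} (inj₁ (inj₂ (inj₁ (2≤x , x≤a , c<y , y≤cl)))) =
    ≤-trans (n≤1+n 1) 2≤x , ≤-trans x≤a a≤m , ≤-trans (s≤s z≤n) c<y , ≤-trans y≤cl c+l≤n , λ (a<x , _) → <⇒≱ a<x x≤a
  inC {_ , _} (inj₁ (inj₂ (inj₂ (inj₁ (2≤x , x≤a , cl<y , y≤n))))) =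
    ≤-trans (n≤1+n 1) 2≤x , ≤-trans x≤a a≤m , ≤-trans (s≤s z≤n) cl<y , y≤n , λ (_ , _ , y≤cl) → <⇒≱ cl<y y≤cl
  inC {_ , _} (inj₁ (inj₂ (inj₂ (inj₂ (a<x , x≤m , cl<y , y≤n))))) =
    ≤-trans (s≤s z≤n) a<x , x≤m , ≤-trans (s≤s z≤n) cl<y , y≤n , λ (_ , _ , y≤cl) → <⇒≱ cl<y y≤cl
  inC {_ , _} (inj₂ (1≤x , x≤1 , 1≤y , y≤n)) =
    1≤x , ≤-trans x≤1 (≤-trans 1≤a a≤m) , 1≤y , y≤n , λ (a<x , _) → <⇒≱ a<x (≤-trans x≤1 1≤a)

Body⇒2≤x : ∀ {a m n c l x y} → 1 ≤ a → Body a m n c l (x , y) → 2 ≤ x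
Body⇒2≤x _   (inj₁ (inj₁ (2≤x , _)))        = 2≤x
Body⇒2≤x 1≤a (inj₁ (inj₂ (a<x , _)))        = ≤-trans (s≤s 1≤a) a<x
Body⇒2≤x _   (inj₂ (inj₁ (2≤x , _)))        = 2≤x
Body⇒2≤x _   (inj₂ (inj₂ (inj₁ (2≤x , _)))) = 2≤x
Body⇒2≤x 1≤a (inj₂ (inj₂ (inj₂ (a<x , _)))) = ≤-trans (s≤s 1≤a) a<x

InC-column : ∀ {m n k l c y} → 1 ≤ m ∸ k → 1 ≤ y → y ≤ n → InC m n k l c (1 , y)
InC-column {m} {k = k} 1≤a 1≤y y≤n = ≤-refl , ≤-trans 1≤a (m∸n≤m m k) , 1≤y , y≤n , λ (a<1 , _) → <⇒≱ a<1 1≤a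

bodyPath⇒HamiltonianCycle : ∀ {m n k l c} → k < m → 1 ≤ c → 1 ≤ l → suc (c + l) ≤ n →
                            HamiltonianPath (Body (m ∸ k) m n c l) (2 , 1) (2 , n) → HamiltonianCycle (InC m n k l c)
bodyPath⇒HamiltonianCycle {m} {n} {k} {l} {c} k<m 1≤c 1≤l cl<n P =
  closePath cyclePath (adj→ 1 1) (1 , 1) (1 , 2) (1 , 3) (onColumn ≤-refl (≤-trans (s≤s z≤n) 3≤n))
    (onColumn (s≤s z≤n) (≤-trans (n≤1+n 2) 3≤n)) (onColumn (s≤s z≤n) 3≤n) (λ ()) (λ ()) (λ ())
  where
  1≤a : 1 ≤ m ∸ k
  1≤a = m<n⇒0<n∸m k<m
  3≤n : 3 ≤ n
  3≤n = ≤-trans (s≤s (+-mono-≤ 1≤c 1≤l)) cl<n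
  cyclePath : HamiltonianPath (InC m n k l c) (2 , 1) (1 , 1)
  cyclePath = HamiltonianPath-cong (≐-sym (InC≐Body∪column {m} {n} {k} {l} {c} 1≤a (<⇒≤ cl<n)))
    (joinPaths P (columnUp 1 (≤-trans (s≤s z≤n) 3≤n)) (adj← 1 n)
               λ { {_ , _} (body , (_ , x≤1 , _)) → <⇒≱ (Body⇒2≤x 1≤a body) x≤1 })
  onColumn : ∀ {y} → 1 ≤ y → y ≤ n → InC m n k l c (1 , y)
  onColumn = InC-column {k = k} {l} {c} 1≤a

-- Degrees

box≡cartesianProduct : ∀ m n → box m n ≡ cartesianProductWith (λ i j → (suc i , suc j)) (upTo m) (upTo n)
box≡cartesianProduct m n = go (upTo m)
  where
  go : ∀ is → concatMap (λ i → map (λ j → (suc i , suc j)) (upTo n)) is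
              ≡ cartesianProductWith (λ i j → (suc i , suc j)) is (upTo n)
  go []       = refl
  go (i ∷ is) = cong (map (λ j → (suc i , suc j)) (upTo n) ++_) (go is)

box-unique : ∀ m n → Unique (box m n)
box-unique m n rewrite box≡cartesianProduct m n =
  Unique.cartesianProductWith⁺ _ (λ { refl → refl , refl }) (Unique.upTo⁺ m) (Unique.upTo⁺ n)

InC⇒∈box : ∀ {m n k l c p} → InC m n k l c p → p ∈ box m n
InC⇒∈box {m} {n} {p = suc i , suc j} (_ , x≤m , _ , y≤n , _) rewrite box≡cartesianProduct m n =
  ∈-cartesianProductWith⁺ _ (∈-upTo⁺ x≤m) (∈-upTo⁺ y≤n)

distinct-∈⇒2≤length : ∀ {p q : Point} xs → p ∈ xs → q ∈ xs → p ≢ q → 2 ≤ length xs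
distinct-∈⇒2≤length (_ ∷ _ ∷ _) _ _ _ = s≤s (s≤s z≤n)
distinct-∈⇒2≤length (_ ∷ []) (here refl) (here refl) p≢q = ⊥-elim (p≢q refl)

2≤degC : ∀ {m n k l c w p q} → InC m n k l c p → InC m n k l c q → Adj w p → Adj w q → p ≢ q →
         2 ≤ degC m n k l c w
2≤degC {m} {n} {k} {l} {c} {w} vp vq w~p w~q p≢q =
  distinct-∈⇒2≤length _ (∈-filter⁺ neighbour? (InC⇒∈box {k = k} {l} {c} vp) (w~p , vp))
                        (∈-filter⁺ neighbour? (InC⇒∈box {k = k} {l} {c} vq) (w~q , vq)) p≢q
  where
  neighbour? : ∀ v → Dec (Adj w v × InC m n k l c v)
  neighbour? v = Adj? w v ×-dec InC? m n k l c v

HamiltonianCycle⇒degC≢1 : ∀ {m n k l c w} → HamiltonianCycle (InC m n k l c) → InC m n k l c w →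
                          degC m n k l c w ≢ 1
HamiltonianCycle⇒degC≢1 {m} {n} {k} {l} {c} hc vw deg≡1 with cycle-twoNeighbours (rotateCycle hc vw)
... | _ , _ , vp , vq , p≢q , w~p , w~q =
  <⇒≱ (2≤degC {m} {n} {k} {l} {c} vp vq w~p w~q p≢q) (≤-reflexive deg≡1)

length-filter≡1 : ∀ {P : Point → Set} (P? : ∀ v → Dec (P v)) xs {u} → Unique xs → u ∈ xs → P u →
                  (∀ {v} → P v → v ≡ u) → length (filter P? xs) ≡ 1
length-filter≡1 P? (x ∷ xs) (x∉ ∷ _) (here refl) Pu only
  rewrite filter-accept P? {x} {xs} Pu
        | filter-none P? {xs} (All.tabulate λ v∈ Pv → All.lookup x∉ v∈ (sym (only Pv))) = refl
length-filter≡1 P? (x ∷ xs) (x∉ ∷ uq) (there u∈) Pu only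
  rewrite filter-reject P? {x} {xs} (λ Px → All.lookup x∉ u∈ (only Px)) = length-filter≡1 P? xs uq u∈ Pu only

degC≡1 : ∀ {m n k l c w u} → InC m n k l c u → Adj w u → (∀ {v} → Adj w v → InC m n k l c v → v ≡ u) →
         degC m n k l c w ≡ 1
degC≡1 {m} {n} {k} {l} {c} {w} vu w~u only =
  length-filter≡1 (λ v → Adj? w v ×-dec InC? m n k l c v) (box m n) (box-unique m n)
    (InC⇒∈box {k = k} {l} {c} vu) (w~u , vu) (λ (w~v , vv) → only w~v vv)

neighbour-inRow : ∀ {x₀ y₀ x y} → Adj (suc x₀ , y₀) (x , y) → x ≤ suc x₀ → y ≡ y₀ → x ≡ x₀
neighbour-inRow {x₀} {x = x} (w≢v , near-x , _) x≤ refl with x ≟ suc x₀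
... | yes refl = ⊥-elim (w≢v refl)
... | no  x≢  = ≤-antisym (s≤s⁻¹ (≤∧≢⇒< x≤ x≢)) (s≤s⁻¹ (∣m-n∣≤1⇒m≤1+n (suc x₀) x near-x))

-- Since k ≥ 2, the column x = m - 1 next to the corner column borders the hole.
m∸k<pred[m] : ∀ {m'' k} → 2 ≤ k → suc (suc m'') ∸ k < suc m''
m∸k<pred[m] {m''} 2≤k = s≤s (∸-monoʳ-≤ (suc (suc m'')) 2≤k)

degC-topCorner : ∀ {m n k l} → 2 ≤ m → 2 ≤ k → 1 ≤ l → 1 ≤ n → degC m n k l 1 (m , 1) ≡ 1
degC-topCorner {suc zero} (s≤s ())
degC-topCorner {suc (suc m'')} {n} {k} {l} _ 2≤k 1≤l 1≤n =
  degC≡1 {k = k} {l} {1} (s≤s z≤n , n≤1+n _ , ≤-refl , 1≤n , λ (_ , 1<1 , _) → <⇒≱ 1<1 ≤-refl) (adj← _ 1) only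
  where
  only : ∀ {v} → Adj (suc (suc m'') , 1) v → InC (suc (suc m'')) n k l 1 v → v ≡ (suc m'' , 1)
  only {x , y} w~v@(_ , near-x , near-y) (_ , x≤m , 1≤y , _ , notHole) with y ≤? 1
  ... | yes y≤1 = cong₂ _,_ (neighbour-inRow w~v x≤m (≤-antisym y≤1 1≤y)) (≤-antisym y≤1 1≤y)
  ... | no  y≰1 = ⊥-elim (notHole (≤-trans (m∸k<pred[m] 2≤k) (s≤s⁻¹ (∣m-n∣≤1⇒m≤1+n _ x near-x)) ,
                                   ≰⇒> y≰1 , ≤-trans (∣m-n∣≤1⇒m≤1+n y 1 (∣m-n∣≤1⇒∣n-m∣≤1 1 y near-y)) (s≤s 1≤l)))

degC-bottomCorner : ∀ {m k l c} → 2 ≤ m → 2 ≤ k → 1 ≤ l → degC m (suc (c + l)) k l c (m , suc (c + l)) ≡ 1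
degC-bottomCorner {suc zero} (s≤s ())
degC-bottomCorner {suc (suc m'')} {k} {l} {c} _ 2≤k 1≤l =
  degC≡1 {k = k} {l} {c} (s≤s z≤n , n≤1+n _ , s≤s z≤n , ≤-refl , λ (_ , _ , n≤cl) → <⇒≱ ≤-refl n≤cl) (adj← _ _) only
  where
  only : ∀ {v} → Adj (suc (suc m'') , suc (c + l)) v → InC (suc (suc m'')) (suc (c + l)) k l c v →
         v ≡ (suc m'' , suc (c + l))
  only {x , y} w~v@(_ , near-x , near-y) (_ , x≤m , _ , y≤n , notHole) with y ≤? c + l
  ... | yes y≤cl = ⊥-elim (notHole (≤-trans (m∸k<pred[m] 2≤k) (s≤s⁻¹ (∣m-n∣≤1⇒m≤1+n _ x near-x)) ,
                                     ≤-trans (m<m+n c 1≤l) (s≤s⁻¹ (∣m-n∣≤1⇒m≤1+n _ y near-y)) , y≤cl))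
  ... | no  y≰cl = cong₂ _,_ (neighbour-inRow w~v x≤m (≤-antisym y≤n (≰⇒> y≰cl))) (≤-antisym y≤n (≰⇒> y≰cl))

HasDegreeOneVertex : ℕ → ℕ → ℕ → ℕ → ℕ → Set
HasDegreeOneVertex m n k l c = ∃ λ w → InC m n k l c w × (degC m n k l c w ≡ 1)

¬HasDegreeOneVertex⇒k≡1⊎1<c : ∀ {m n k l c} → 2 ≤ m → 1 ≤ k → 1 ≤ c → 1 ≤ l → 1 ≤ n →
                                ¬ HasDegreeOneVertex m n k l c → suc (m ∸ k) ≡ m ⊎ 1 < c
¬HasDegreeOneVertex⇒k≡1⊎1<c {suc zero} (s≤s ())
¬HasDegreeOneVertex⇒k≡1⊎1<c {suc (suc m'')} 2≤m 1≤k 1≤c 1≤l 1≤n noDeg1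
  with m≤n⇒m<n∨m≡n 1≤c | m≤n⇒m<n∨m≡n 1≤k
... | inj₁ 1<c  | _         = inj₂ 1<c
... | inj₂ refl | inj₂ refl = inj₁ refl
... | inj₂ refl | inj₁ 2≤k  =
  ⊥-elim (noDeg1 (_ , (s≤s z≤n , ≤-refl , ≤-refl , 1≤n , λ (_ , 1<1 , _) → <⇒≱ 1<1 ≤-refl) ,
                      degC-topCorner 2≤m 2≤k 1≤l 1≤n))

¬HasDegreeOneVertex⇒k≡1⊎1<d : ∀ {m n k l c} → 2 ≤ m → 1 ≤ k → 1 ≤ l → suc (c + l) ≤ n →
                                ¬ HasDegreeOneVertex m n k l c → suc (m ∸ k) ≡ m ⊎ suc (c + l) < n
¬HasDegreeOneVertex⇒k≡1⊎1<d {suc zero} (s≤s ())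
¬HasDegreeOneVertex⇒k≡1⊎1<d {suc (suc m'')} 2≤m 1≤k 1≤l cl<n noDeg1
  with m≤n⇒m<n∨m≡n cl<n | m≤n⇒m<n∨m≡n 1≤k
... | inj₁ 1<d  | _         = inj₂ 1<d
... | inj₂ refl | inj₂ refl = inj₁ refl
... | inj₂ refl | inj₁ 2≤k  =
  ⊥-elim (noDeg1 (_ , (s≤s z≤n , ≤-refl , s≤s z≤n , ≤-refl , λ (_ , _ , n≤cl) → <⇒≱ ≤-refl n≤cl) ,
                      degC-bottomCorner 2≤m 2≤k 1≤l))

HamiltonianCycle⇒a≢1 : ∀ {m n k l c} → m ∸ k ≡ 1 → 1 ≤ c → 1 ≤ l → suc (c + l) ≤ n →
                       ¬ HamiltonianCycle (InC m n k l c)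
HamiltonianCycle⇒a≢1 {m} {n} {k} {l} {c} a≡1 1≤c 1≤l cl<n hc
  with rotateCycle hc (InC-column {k = k} {l} {c} (≤-reflexive (sym a≡1)) (s≤s z≤n) (≤-trans (s≤s (m≤m+n c l)) cl<n))
... | ys , z∉ys ∷ _ , _ , cov , closed =
  <⇒≱ (≤-trans (s≤s (m≤m+n c l)) cl<n)
      (Consec-transport step ys (Consec-prefix ys _ (Consec-tail z _ closed)) inG
         (onColumn ≤-refl (≤-trans (s≤s z≤n) cl<n) (λ 1≡1+c → <⇒≱ 1≤c (≤-reflexive (sym (suc-injective (cong proj₂ 1≡1+c))))))
         (onColumn (≤-trans (s≤s z≤n) cl<n) ≤-refl (λ n≡1+c → <⇒≱ (≤-trans (s≤s (m<m+n c 1≤l)) cl<n) (≤-reflexive (cong proj₂ n≡1+c))))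
         1≤c)
  where
  1≤a : 1 ≤ m ∸ k
  1≤a = ≤-reflexive (sym a≡1)
  z : Point
  z = (1 , suc c)
  G : Point → Set
  G p = InC m n k l c p × p ≢ z
  inG : ∀ {p} → p ∈ ys → G p
  inG p∈ = Equivalence.from (cov _) (there p∈) , λ { refl → All.lookup z∉ys p∈ refl }
  onColumn : ∀ {y} → 1 ≤ y → y ≤ n → (1 , y) ≢ z → (1 , y) ∈ ys
  onColumn 1≤y y≤n ≢z with Equivalence.to (cov _) (InC-column {k = k} {l} {c} 1≤a 1≤y y≤n)
  ... | here refl = ⊥-elim (≢z refl)
  ... | there p∈  = p∈
  step : ∀ {p q} → G p → G q → Adj p q → proj₂ p ≤ c → proj₂ q ≤ c
  step {_ , py} {qx , qy} _ ((1≤qx , _ , _ , _ , notHole) , q≢z) (_ , _ , near-y) py≤c with qy ≤? c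
  ... | yes qy≤c = qy≤c
  ... | no  qy≰c = ⊥-elim (q≢z (cong₂ _,_ qx≡1 qy≡1+c))
    where
    qy≡1+c : qy ≡ suc c
    qy≡1+c = ≤-antisym (≤-trans (∣m-n∣≤1⇒m≤1+n qy py (∣m-n∣≤1⇒∣n-m∣≤1 py qy near-y)) (s≤s py≤c)) (≰⇒> qy≰c)
    qx≡1 : qx ≡ 1
    qx≡1 with qx ≤? m ∸ k
    ... | yes qx≤a = ≤-antisym (≤-trans qx≤a (≤-reflexive a≡1)) 1≤qx
    ... | no  qx≰a = ⊥-elim (notHole (≰⇒> qx≰a , ≰⇒> qy≰c , subst (_≤ c + l) (sym qy≡1+c) (m<m+n c 1≤l)))

theorem4 : (m n k l c d : ℕ) →
    2 ≤ m → 3 ≤ n → 1 ≤ k → 1 ≤ l → 1 ≤ c → 1 ≤ d → d ≡ n ∸ l ∸ c → c + l + d ≡ n → k < m →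
    HamiltonianCycle (InC m n k l c) ⇔
      (¬ ((m ∸ k ≡ 1) ⊎ (∃ λ w → InC m n k l c w × (degC m n k l c w ≡ 1))))
theorem4 m n k l c d 2≤m _ 1≤k 1≤l 1≤c 1≤d _ c+l+d≡n k<m = mk⇔ necessary sufficient
  where
  cl<n : suc (c + l) ≤ n
  cl<n = subst (suc (c + l) ≤_) c+l+d≡n (subst (_≤ c + l + d) (+-comm (c + l) 1) (+-monoʳ-≤ (c + l) 1≤d))
  necessary : HamiltonianCycle (InC m n k l c) → ¬ (m ∸ k ≡ 1 ⊎ HasDegreeOneVertex m n k l c)
  necessary hc (inj₁ a≡1)              = HamiltonianCycle⇒a≢1 {m} {n} {k} {l} {c} a≡1 1≤c 1≤l cl<n hc
  necessary hc (inj₂ (_ , vw , deg≡1)) = HamiltonianCycle⇒degC≢1 {m} {n} {k} {l} {c} hc vw deg≡1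
  sufficient : ¬ (m ∸ k ≡ 1 ⊎ HasDegreeOneVertex m n k l c) → HamiltonianCycle (InC m n k l c)
  sufficient bad =
    bodyPath⇒HamiltonianCycle k<m 1≤c 1≤l cl<n
      (bodyPath 2≤a a<m cl<n 1≤c 1≤l
        (¬HasDegreeOneVertex⇒k≡1⊎1<c 2≤m 1≤k 1≤c 1≤l (≤-trans (s≤s z≤n) cl<n) (bad ∘ inj₂))
        (¬HasDegreeOneVertex⇒k≡1⊎1<d 2≤m 1≤k 1≤l cl<n (bad ∘ inj₂)))
    where
    2≤a : 2 ≤ m ∸ k
    2≤a = ≤∧≢⇒< (m<n⇒0<n∸m k<m) (λ 1≡a → bad (inj₁ (sym 1≡a)))
    a<m : suc (m ∸ k) ≤ m
    a<m = ∸-monoʳ-< 1≤k (<⇒≤ k<m)
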